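{- Over the calculus QHC (described in the context): (a) The $!$-Principle $!(p\to q)\leftrightarrow\nabla(!p\to !q)$ is strictly stronger than the $?^*$-Principle $(?\alpha\to ?\beta)\leftrightarrow ?(\nabla\alpha\to\nabla\beta)$, which is in turn strictly stronger than the $?$-Principle $?(\alpha\to\beta)\leftrightarrow\Box(?\alpha\to ?\beta)$. (b) Kolmogorov's Stability Principle $!\neg p\leftrightarrow\neg !p$ is strictly stronger than Hilbert's No Ignorabimus Principle $?\neg\alpha\leftrightarrow\neg ?\alpha$.
   Context: QHC (the joint logic of problems and propositions) is a two-sorted first-order calculus over a single domain of individuals. Formulas are of two sorts: propositions (letters $p,q$) and problems (letters $\alpha,\beta$). Propositions are built from atomic propositions and from expressions $?\alpha$ ($\alpha$ a problem) by the classical connectives $\land,\lor,\to,\neg$, the constant $0$ (falsity) and quantifiers $\forall x,\exists x$. Problems are built from atomic problems and from expressions $!p$ ($p$ a proposition) by the intuitionistic connectives $\land,\lor,\to,\neg$, the constant $\bot$ and quantifiers $\forall x,\exists x$. Derivability in QHC: all axioms and rules of classical predicate logic apply to propositions, all axioms and rules of intuitionistic predicate logic apply to problems, and in addition there are the inference rules "from $\alpha$ infer $?\alpha$" and "from $p$ infer $!p$", and the axiom schemes $?(\alpha\to\beta)\to(?\alpha\to ?\beta)$, $!(p\to q)\to(!p\to !q)$, $\neg !0$, $?!p\to p$, $\alpha\to !?\alpha$. Abbreviations: $\Box p:= ?!p$ for propositions, $\nabla\alpha := !?\alpha$ for problems; $A\leftrightarrow B$ abbreviates $(A\to B)\land(B\to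 A)$. A principle is a schema added to QHC as extra axioms (all instances for arbitrary formulas of the indicated sorts). Principle X is strictly stronger than principle Y if Y is derivable in QHC extended by X, but X is not derivable in QHC extended by Y. -}

module Defs where

open import Data.Nat using (ℕ; zero; suc)
open import Data.List using (List; map)
open import Data.Product using (Σ; _×_; ∃-syntax)
open import Data.Empty using (⊥)
open import Relation.Binary.PropositionalEquality using (_≡_)
open import Relation.Nullary using (¬_)

-- Individual terms are variables, in de Bruijn notation (ℕ).

Term : Set
Term = ℕ

infixr 6 _∧_ _∧ᵇ_
infixr 5 _∨_ _∨ᵇ_
infixr 4 _⇒_ _⇒ᵇ_
infix 3 _⇔_ _⇔ᵇ_
infix 9 ¿_ ¡_ ~_ ~ᵇ_ □_ ∇_

mutual
  data Prp : Set where
    atomP : ℕ → List Term → Prp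
    ¿_    : Prb → Prp
    _∧_ _∨_ _⇒_ : Prp → Prp → Prp
    ~_    : Prp → Prp
    𝟘     : Prp
    ∀p ∃p : Prp → Prp               -- binds de Bruijn variable 0

  data Prb : Set where
    atomB : ℕ → List Term → Prb
    ¡_    : Prp → Prb
    _∧ᵇ_ _∨ᵇ_ _⇒ᵇ_ : Prb → Prb → Prb
    ~ᵇ_   : Prb → Prb
    ⊥ᵇ    : Prb
    ∀b ∃b : Prb → Prb               -- binds de Bruijn variable 0

-- Renaming of individual variables (since terms are variables, this is
-- also substitution).

lift : (ℕ → ℕ) → ℕ → ℕ
lift ρ zero    = zero
lift ρ (suc n) = suc (ρ n)

mutual
  renP : (ℕ → ℕ) → Prp → Prp
  renP ρ (atomP P ts) = atomP P (map ρ ts)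
  renP ρ (¿ a)   = ¿ renB ρ a
  renP ρ (p ∧ q) = renP ρ p ∧ renP ρ q
  renP ρ (p ∨ q) = renP ρ p ∨ renP ρ q
  renP ρ (p ⇒ q) = renP ρ p ⇒ renP ρ q
  renP ρ (~ p)   = ~ renP ρ p
  renP ρ 𝟘       = 𝟘
  renP ρ (∀p p)  = ∀p (renP (lift ρ) p)
  renP ρ (∃p p)  = ∃p (renP (lift ρ) p)

  renB : (ℕ → ℕ) → Prb → Prb
  renB ρ (atomB P ts) = atomB P (map ρ ts)
  renB ρ (¡ p)    = ¡ renP ρ p
  renB ρ (a ∧ᵇ b) = renB ρ a ∧ᵇ renB ρ b
  renB ρ (a ∨ᵇ b) = renB ρ a ∨ᵇ renB ρ b
  renB ρ (a ⇒ᵇ b) = renB ρ a ⇒ᵇ renB ρ b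
  renB ρ (~ᵇ a)   = ~ᵇ renB ρ a
  renB ρ ⊥ᵇ       = ⊥ᵇ
  renB ρ (∀b a)   = ∀b (renB (lift ρ) a)
  renB ρ (∃b a)   = ∃b (renB (lift ρ) a)

sub0 : Term → ℕ → ℕ
sub0 t zero    = t
sub0 t (suc n) = n

instP : Prp → Term → Prp
instP p t = renP (sub0 t) p

instB : Prb → Term → Prb
instB a t = renB (sub0 t) a

-- weakening (the formula does not contain the newly bound variable 0)
shP : Prp → Prp
shP = renP suc

shB : Prb → Prb
shB = renB suc

_⇔_ : Prp → Prp → Prp
p ⇔ q = (p ⇒ q) ∧ (q ⇒ p)

_⇔ᵇ_ : Prb → Prb → Prb
a ⇔ᵇ b = (a ⇒ᵇ b) ∧ᵇ (b ⇒ᵇ a)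

□_ : Prp → Prp
□ p = ¿ (¡ p)

∇_ : Prb → Prb
∇ a = ¡ (¿ a)

record Theory : Set₁ where
  field
    axP : Prp → Set
    axB : Prb → Set
open Theory public

mutual
  data _⊢P_ (T : Theory) : Prp → Set where
    extra  : ∀ {p} → axP T p → T ⊢P p
    K      : ∀ {p q} → T ⊢P (p ⇒ q ⇒ p)
    S      : ∀ {p q r} → T ⊢P ((p ⇒ q ⇒ r) ⇒ (p ⇒ q) ⇒ p ⇒ r)
    ∧I     : ∀ {p q} → T ⊢P (p ⇒ q ⇒ p ∧ q)
    ∧E₁    : ∀ {p q} → T ⊢P (p ∧ q ⇒ p)
    ∧E₂    : ∀ {p q} → T ⊢P (p ∧ q ⇒ q)
    ∨I₁    : ∀ {p q} → T ⊢P (p ⇒ p ∨ q)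
    ∨I₂    : ∀ {p q} → T ⊢P (q ⇒ p ∨ q)
    ∨E     : ∀ {p q r} → T ⊢P ((p ⇒ r) ⇒ (q ⇒ r) ⇒ p ∨ q ⇒ r)
    efq    : ∀ {p} → T ⊢P (𝟘 ⇒ p)
    ¬I     : ∀ {p} → T ⊢P ((p ⇒ 𝟘) ⇒ ~ p)
    ¬E     : ∀ {p} → T ⊢P (~ p ⇒ p ⇒ 𝟘)
    dne    : ∀ {p} → T ⊢P (~ (~ p) ⇒ p)
    mp     : ∀ {p q} → T ⊢P (p ⇒ q) → T ⊢P p → T ⊢P q
    ∀E     : ∀ {p} (t : Term) → T ⊢P (∀p p ⇒ instP p t)
    ∃I     : ∀ {p} (t : Term) → T ⊢P (instP p t ⇒ ∃p p)
    gen    : ∀ {p} → T ⊢P p → T ⊢P ∀p p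
    ∀R     : ∀ {q p} → T ⊢P (shP q ⇒ p) → T ⊢P (q ⇒ ∀p p)
    ∃R     : ∀ {q p} → T ⊢P (p ⇒ shP q) → T ⊢P (∃p p ⇒ q)
    ¿rule  : ∀ {a} → T ⊢B a → T ⊢P (¿ a)
    ¿K     : ∀ {a b} → T ⊢P (¿ (a ⇒ᵇ b) ⇒ ¿ a ⇒ ¿ b)
    ¿¡E    : ∀ {p} → T ⊢P (¿ (¡ p) ⇒ p)

  data _⊢B_ (T : Theory) : Prb → Set where
    extra  : ∀ {a} → axB T a → T ⊢B a
    K      : ∀ {a b} → T ⊢B (a ⇒ᵇ b ⇒ᵇ a)
    S      : ∀ {a b c} → T ⊢B ((a ⇒ᵇ b ⇒ᵇ c) ⇒ᵇ (a ⇒ᵇ b) ⇒ᵇ a ⇒ᵇ c)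
    ∧I     : ∀ {a b} → T ⊢B (a ⇒ᵇ b ⇒ᵇ a ∧ᵇ b)
    ∧E₁    : ∀ {a b} → T ⊢B (a ∧ᵇ b ⇒ᵇ a)
    ∧E₂    : ∀ {a b} → T ⊢B (a ∧ᵇ b ⇒ᵇ b)
    ∨I₁    : ∀ {a b} → T ⊢B (a ⇒ᵇ a ∨ᵇ b)
    ∨I₂    : ∀ {a b} → T ⊢B (b ⇒ᵇ a ∨ᵇ b)
    ∨E     : ∀ {a b c} → T ⊢B ((a ⇒ᵇ c) ⇒ᵇ (b ⇒ᵇ c) ⇒ᵇ a ∨ᵇ b ⇒ᵇ c)
    efq    : ∀ {a} → T ⊢B (⊥ᵇ ⇒ᵇ a)
    ¬I     : ∀ {a} → T ⊢B ((a ⇒ᵇ ⊥ᵇ) ⇒ᵇ ~ᵇ a)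
    ¬E     : ∀ {a} → T ⊢B (~ᵇ a ⇒ᵇ a ⇒ᵇ ⊥ᵇ)
    mp     : ∀ {a b} → T ⊢B (a ⇒ᵇ b) → T ⊢B a → T ⊢B b
    ∀E     : ∀ {a} (t : Term) → T ⊢B (∀b a ⇒ᵇ instB a t)
    ∃I     : ∀ {a} (t : Term) → T ⊢B (instB a t ⇒ᵇ ∃b a)
    gen    : ∀ {a} → T ⊢B a → T ⊢B ∀b a
    ∀R     : ∀ {c a} → T ⊢B (shB c ⇒ᵇ a) → T ⊢B (c ⇒ᵇ ∀b a)
    ∃R     : ∀ {c a} → T ⊢B (a ⇒ᵇ shB c) → T ⊢B (∃b a ⇒ᵇ c)
    ¡rule  : ∀ {p} → T ⊢P p → T ⊢B (¡ p)
    ¡K     : ∀ {p q} → T ⊢B (¡ (p ⇒ q) ⇒ᵇ ¡ p ⇒ᵇ ¡ q)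
    ¬¡𝟘    : T ⊢B (~ᵇ (¡ 𝟘))
    ∇I     : ∀ {a} → T ⊢B (a ⇒ᵇ ∇ a)

BangPrinciple : Theory
BangPrinciple .axP _ = ⊥
BangPrinciple .axB φ = ∃[ p ] ∃[ q ] (φ ≡ (¡ (p ⇒ q) ⇔ᵇ ∇ (¡ p ⇒ᵇ ¡ q)))

QStarPrinciple : Theory
QStarPrinciple .axP φ = ∃[ a ] ∃[ b ] (φ ≡ ((¿ a ⇒ ¿ b) ⇔ ¿ (∇ a ⇒ᵇ ∇ b)))
QStarPrinciple .axB _ = ⊥

QPrinciple : Theory
QPrinciple .axP φ = ∃[ a ] ∃[ b ] (φ ≡ (¿ (a ⇒ᵇ b) ⇔ □ (¿ a ⇒ ¿ b)))
QPrinciple .axB _ = ⊥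

StabilityPrinciple : Theory
StabilityPrinciple .axP _ = ⊥
StabilityPrinciple .axB φ = ∃[ p ] (φ ≡ (¡ (~ p) ⇔ᵇ ~ᵇ (¡ p)))

NoIgnorabimusPrinciple : Theory
NoIgnorabimusPrinciple .axP φ = ∃[ a ] (φ ≡ (¿ (~ᵇ a) ⇔ ~ (¿ a)))
NoIgnorabimusPrinciple .axB _ = ⊥

Derives : Theory → Theory → Set
Derives X Y = (∀ p → axP Y p → X ⊢P p) × (∀ a → axB Y a → X ⊢B a)

StrictlyStronger : Theory → Theory → Set
StrictlyStronger X Y = Derives X Y × ¬ Derives Y X

-- Derivability goes through the converses ¬!p → !¬p and ¬?α → ?¬α: the
-- !-principle and stability each give the first, the first gives the second,
-- and so does the ?*-principle.  The second yields the No Ignorabimus, ?- and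
-- ?*-principles, because classically ?α → ?β then forces ?(α → β).
-- Non-derivability follows from soundness for two finite algebraic models
-- interpreting propositions in the four-element Boolean algebra and problems
-- in the three-element Gödel chain.

module Submission where

open import Defs
open import Data.Bool as Bool using (Bool; true; false; not; if_then_else_)
open import Data.Bool.Instances
open import Data.Fin using (Fin; zero; fromℕ)
open import Data.Fin.Instances
open import Data.Fin.Patterns using (0F; 1F; 2F)
import Data.Fin.Properties as Fin
open import Data.List using (List; []; _∷_)
open import Data.List.Membership.Propositional using (_∈_)
open import Data.List.Relation.Unary.Any using (here; there)
open import Data.Nat using (ℕ; suc)
open import Data.Product using (_×_; _,_)
open import Data.Product.Instances
open import Relation.Binary.PropositionalEquality using (_≡_; refl; sym; trans; cong; cong₂; subst)
open import Relation.Binary.Structures using (IsDecEquivalence)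
open import Relation.Binary.TypeClasses using (_≟_)
open import Relation.Nullary using (¬_; Dec; does)
open import Relation.Nullary.Decidable using (True; toWitness; map′; _×-dec_)
open import Relation.Unary using (Decidable)

infixl 5 _·_
infix 2 _∣_⊢ᴾ_ _∣_⊢ᴮ_

data _∣_⊢ᴾ_ (T : Theory) (Γ : List Prp) : Prp → Set where
  hyp : ∀ {p} → p ∈ Γ → T ∣ Γ ⊢ᴾ p
  thm : ∀ {p} → T ⊢P p → T ∣ Γ ⊢ᴾ p
  _·_ : ∀ {p q} → T ∣ Γ ⊢ᴾ (p ⇒ q) → T ∣ Γ ⊢ᴾ p → T ∣ Γ ⊢ᴾ q

data _∣_⊢ᴮ_ (T : Theory) (Γ : List Prb) : Prb → Set where
  hyp : ∀ {a} → a ∈ Γ → T ∣ Γ ⊢ᴮ a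
  thm : ∀ {a} → T ⊢B a → T ∣ Γ ⊢ᴮ a
  _·_ : ∀ {a b} → T ∣ Γ ⊢ᴮ (a ⇒ᵇ b) → T ∣ Γ ⊢ᴮ a → T ∣ Γ ⊢ᴮ b

module _ {T : Theory} where

  ⇒-refl : ∀ {p} → T ⊢P (p ⇒ p)
  ⇒-refl {p} = mp (mp (S {q = p ⇒ p}) K) K

  ⇒ᵇ-refl : ∀ {a} → T ⊢B (a ⇒ᵇ a)
  ⇒ᵇ-refl {a} = mp (mp (S {b = a ⇒ᵇ a}) K) K

  deduction : ∀ {Γ p q} → T ∣ p ∷ Γ ⊢ᴾ q → T ∣ Γ ⊢ᴾ (p ⇒ q)
  deduction (hyp (here refl)) = thm ⇒-refl
  deduction (hyp (there x))   = thm K · hyp x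
  deduction (thm d)           = thm K · thm d
  deduction (d · e)           = thm S · deduction d · deduction e

  deductionᵇ : ∀ {Γ a b} → T ∣ a ∷ Γ ⊢ᴮ b → T ∣ Γ ⊢ᴮ (a ⇒ᵇ b)
  deductionᵇ (hyp (here refl)) = thm ⇒ᵇ-refl
  deductionᵇ (hyp (there x))   = thm K · hyp x
  deductionᵇ (thm d)           = thm K · thm d
  deductionᵇ (d · e)           = thm S · deductionᵇ d · deductionᵇ e

  closed : ∀ {p} → T ∣ [] ⊢ᴾ p → T ⊢P p
  closed (thm d) = d
  closed (d · e) = mp (closed d) (closed e)

  closedᵇ : ∀ {a} → T ∣ [] ⊢ᴮ a → T ⊢B a
  closedᵇ (thm d) = d
  closedᵇ (d · e) = mp (closedᵇ d) (closedᵇ e)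

  h₀ : ∀ {Γ p} → T ∣ p ∷ Γ ⊢ᴾ p
  h₀ = hyp (here refl)

  h₁ : ∀ {Γ p q} → T ∣ q ∷ p ∷ Γ ⊢ᴾ p
  h₁ = hyp (there (here refl))

  h₂ : ∀ {Γ p q r} → T ∣ r ∷ q ∷ p ∷ Γ ⊢ᴾ p
  h₂ = hyp (there (there (here refl)))

  hᵇ₀ : ∀ {Γ a} → T ∣ a ∷ Γ ⊢ᴮ a
  hᵇ₀ = hyp (here refl)

  hᵇ₁ : ∀ {Γ a b} → T ∣ b ∷ a ∷ Γ ⊢ᴮ a
  hᵇ₁ = hyp (there (here refl))

  ¬-intro : ∀ {Γ p} → T ∣ p ∷ Γ ⊢ᴾ 𝟘 → T ∣ Γ ⊢ᴾ ~ p
  ¬-intro d = thm ¬I · deduction d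

  ¬-elim : ∀ {Γ p} → T ∣ Γ ⊢ᴾ ~ p → T ∣ Γ ⊢ᴾ p → T ∣ Γ ⊢ᴾ 𝟘
  ¬-elim d e = thm ¬E · d · e

  by-contradiction : ∀ {Γ p} → T ∣ ~ p ∷ Γ ⊢ᴾ 𝟘 → T ∣ Γ ⊢ᴾ p
  by-contradiction d = thm dne · ¬-intro d

  ¬ᵇ-intro : ∀ {Γ a} → T ∣ a ∷ Γ ⊢ᴮ ⊥ᵇ → T ∣ Γ ⊢ᴮ ~ᵇ a
  ¬ᵇ-intro d = thm ¬I · deductionᵇ d

  ¬ᵇ-elim : ∀ {Γ a} → T ∣ Γ ⊢ᴮ ~ᵇ a → T ∣ Γ ⊢ᴮ a → T ∣ Γ ⊢ᴮ ⊥ᵇ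
  ¬ᵇ-elim d e = thm ¬E · d · e

  ⇒-trans : ∀ {p q r} → T ⊢P (p ⇒ q) → T ⊢P (q ⇒ r) → T ⊢P (p ⇒ r)
  ⇒-trans d e = closed (deduction (thm e · (thm d · h₀)))

  ⇔-intro : ∀ {p q} → T ⊢P (p ⇒ q) → T ⊢P (q ⇒ p) → T ⊢P (p ⇔ q)
  ⇔-intro d e = mp (mp ∧I d) e

module _ {T : Theory} where

  ¿-mono : ∀ {a b} → T ⊢B (a ⇒ᵇ b) → T ⊢P (¿ a ⇒ ¿ b)
  ¿-mono d = mp ¿K (¿rule d)

  ¡-mono : ∀ {p q} → T ⊢P (p ⇒ q) → T ⊢B (¡ p ⇒ᵇ ¡ q)
  ¡-mono d = mp ¡K (¡rule d)

  ¡-from-¿ : ∀ {a p} → T ⊢P (¿ a ⇒ p) → T ⊢B (a ⇒ᵇ ¡ p)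
  ¡-from-¿ d = closedᵇ (deductionᵇ (thm (¡-mono d) · (thm ∇I · hᵇ₀)))

  ¿⊥-absurd : T ⊢P (¿ ⊥ᵇ ⇒ 𝟘)
  ¿⊥-absurd = ⇒-trans (¿-mono efq) ¿¡E

  ¡𝟘-absurd : T ⊢B (¡ 𝟘 ⇒ᵇ ⊥ᵇ)
  ¡𝟘-absurd = mp ¬E ¬¡𝟘

  ¡-noncontradiction : ∀ {Γ p} → T ∣ Γ ⊢ᴮ ¡ (~ p) → T ∣ Γ ⊢ᴮ ¡ p → T ∣ Γ ⊢ᴮ ⊥ᵇ
  ¡-noncontradiction d e = thm ¡𝟘-absurd · (thm ¡K · (thm (¡-mono ¬E) · d) · e)

  ~ᵇ-efq : ∀ {a b} → T ⊢B (~ᵇ a ⇒ᵇ a ⇒ᵇ b)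
  ~ᵇ-efq = closedᵇ (deductionᵇ (deductionᵇ (thm efq · ¬ᵇ-elim hᵇ₁ hᵇ₀)))

  ¿~-refutes : ∀ {a} → T ⊢P (¿ (~ᵇ a) ⇒ ~ ¿ a)
  ¿~-refutes = closed (deduction (¬-intro (thm ¿⊥-absurd · (thm ¿K · (thm (¿-mono ¬E) · h₁) · h₀))))

  ∇⊥-refutes : ∀ {a} → T ⊢B ((∇ a ⇒ᵇ ∇ ⊥ᵇ) ⇒ᵇ ~ᵇ a)
  ∇⊥-refutes = closedᵇ (deductionᵇ (¬ᵇ-intro
    (thm ¡𝟘-absurd · (thm (¡-mono ¿⊥-absurd) · (hᵇ₁ · (thm ∇I · hᵇ₀))))))

ConverseStability : Theory → Set
ConverseStability T = ∀ p → T ⊢B (~ᵇ ¡ p ⇒ᵇ ¡ (~ p))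

ConverseNoIgnorabimus : Theory → Set
ConverseNoIgnorabimus T = ∀ a → T ⊢P (~ ¿ a ⇒ ¿ (~ᵇ a))

-- t = ¬?α → ?¬α follows from ?α and from ?¬α, so both α and ¬α solve !t
-- through ∇; hence !¬t is refuted, and converse stability turns ¬!¬t
-- into !¬¬t, that is !t, whence ?!t and t.
converseStability⇒converseNoIgnorabimus :
  ∀ {T} → ConverseStability T → ConverseNoIgnorabimus T
converseStability⇒converseNoIgnorabimus {T} stable a = mp ¿¡E (¿rule ¡t)
  where
  t : Prp
  t = ~ ¿ a ⇒ ¿ (~ᵇ a)

  a⇒¡t : T ⊢B (a ⇒ᵇ ¡ t)
  a⇒¡t = ¡-from-¿ (closed (deduction (deduction (thm efq · ¬-elim h₀ h₁))))

  ~a⇒¡t : T ⊢B (~ᵇ a ⇒ᵇ ¡ t)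
  ~a⇒¡t = ¡-from-¿ K

  ¬¡~t : T ⊢B (~ᵇ ¡ (~ t))
  ¬¡~t = closedᵇ (¬ᵇ-intro (¡-noncontradiction hᵇ₀
    (thm ~a⇒¡t · ¬ᵇ-intro (¡-noncontradiction hᵇ₁ (thm a⇒¡t · hᵇ₀)))))

  ¡t : T ⊢B (¡ t)
  ¡t = mp (¡-mono dne) (mp (stable (~ t)) ¬¡~t)

bang⇒converseStability : ConverseStability BangPrinciple
bang⇒converseStability p = closedᵇ (deductionᵇ (thm (¡-mono ¬I) ·
  (thm ∧E₂ · thm (extra (p , 𝟘 , refl)) · (thm ∇I · (thm ~ᵇ-efq · hᵇ₀)))))

stability⇒converseStability : ConverseStability StabilityPrinciple
stability⇒converseStability p = mp ∧E₂ (extra (p , refl))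

qStar⇒converseNoIgnorabimus : ConverseNoIgnorabimus QStarPrinciple
qStar⇒converseNoIgnorabimus a = closed (deduction (thm (¿-mono ∇⊥-refutes) ·
  (thm ∧E₁ · thm (extra (a , ⊥ᵇ , refl)) · deduction (thm efq · ¬-elim h₁ h₀))))

-- Classically either ¬?α, which the hypothesis turns into ?¬α, or ?α and
-- then ?β; both give ?(α → β).
¿K-converse : ∀ {T a b} → ConverseNoIgnorabimus T → T ⊢P ((¿ a ⇒ ¿ b) ⇒ ¿ (a ⇒ᵇ b))
¿K-converse {a = a} nic = closed (deduction (by-contradiction (¬-elim h₀
  (thm (¿-mono ~ᵇ-efq) · (thm (nic a) · ¬-intro (¬-elim h₁ (thm (¿-mono K) · (h₂ · h₀))))))))

module _ {T : Theory} (nic : ConverseNoIgnorabimus T) where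

  noIgnorabimus-derivable : Derives T NoIgnorabimusPrinciple
  noIgnorabimus-derivable = (λ { _ (a , refl) → ⇔-intro ¿~-refutes (nic a) }) , λ _ ()

  qPrinciple-derivable : Derives T QPrinciple
  qPrinciple-derivable =
    (λ { _ (a , b , refl) → ⇔-intro (¿-mono (¡-from-¿ ¿K)) (⇒-trans ¿¡E (¿K-converse nic)) }) , λ _ ()

  qStarPrinciple-derivable : Derives T QStarPrinciple
  qStarPrinciple-derivable = (λ { _ (a , b , refl) → ⇔-intro forward backward }) , λ _ ()
    where
    forward : ∀ {a b} → T ⊢P ((¿ a ⇒ ¿ b) ⇒ ¿ (∇ a ⇒ᵇ ∇ b))
    forward = ⇒-trans (closed (deduction (deduction (thm (¿-mono ∇I) · (h₁ · (thm ¿¡E · h₀))))))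
                      (¿K-converse nic)

    backward : ∀ {a b} → T ⊢P (¿ (∇ a ⇒ᵇ ∇ b) ⇒ ¿ a ⇒ ¿ b)
    backward = closed (deduction (deduction (thm ¿¡E · (thm ¿K · h₁ · (thm (¿-mono ∇I) · h₀)))))

bang⇒qStar : Derives BangPrinciple QStarPrinciple
bang⇒qStar = qStarPrinciple-derivable
  (converseStability⇒converseNoIgnorabimus bang⇒converseStability)

qStar⇒q : Derives QStarPrinciple QPrinciple
qStar⇒q = qPrinciple-derivable qStar⇒converseNoIgnorabimus

stability⇒noIgnorabimus : Derives StabilityPrinciple NoIgnorabimusPrinciple
stability⇒noIgnorabimus = noIgnorabimus-derivable
  (converseStability⇒converseNoIgnorabimus stability⇒converseStability)

record Connectives (A : Set) : Set where
  infixr 8 _⊓_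
  infixr 7 _⊔_
  infixr 6 _⇛_
  infix 5 _⟺_
  infix 9 ∼_
  field
    ⊤ ⊥ : A
    _⊓_ _⊔_ _⇛_ : A → A → A
    ∼_ : A → A

  _⟺_ : A → A → A
  x ⟺ y = (x ⇛ y) ⊓ (y ⇛ x)

record IsHilbertAlgebra {A : Set} (C : Connectives A) : Set where
  open Connectives C
  field
    K-valid     : ∀ x y → x ⇛ y ⇛ x ≡ ⊤
    S-valid     : ∀ x y z → (x ⇛ y ⇛ z) ⇛ (x ⇛ y) ⇛ x ⇛ z ≡ ⊤
    ∧I-valid    : ∀ x y → x ⇛ y ⇛ x ⊓ y ≡ ⊤
    ∧E₁-valid   : ∀ x y → x ⊓ y ⇛ x ≡ ⊤
    ∧E₂-valid   : ∀ x y → x ⊓ y ⇛ y ≡ ⊤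
    ∨I₁-valid   : ∀ x y → x ⇛ x ⊔ y ≡ ⊤
    ∨I₂-valid   : ∀ x y → y ⇛ x ⊔ y ≡ ⊤
    ∨E-valid    : ∀ x y z → (x ⇛ z) ⇛ (y ⇛ z) ⇛ x ⊔ y ⇛ z ≡ ⊤
    efq-valid   : ∀ x → ⊥ ⇛ x ≡ ⊤
    ¬I-valid    : ∀ x → (x ⇛ ⊥) ⇛ ∼ x ≡ ⊤
    ¬E-valid    : ∀ x → ∼ x ⇛ x ⇛ ⊥ ≡ ⊤
    ⊤⇛-identity : ∀ x → ⊤ ⇛ x ≡ x

  mp-valid : ∀ {x y} → x ⇛ y ≡ ⊤ → x ≡ ⊤ → y ≡ ⊤
  mp-valid {y = y} x⇛y refl = trans (sym (⊤⇛-identity y)) x⇛y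

  ⇛-refl : ∀ x → x ⇛ x ≡ ⊤
  ⇛-refl x = mp-valid (mp-valid (S-valid x (x ⇛ x) x) (K-valid x (x ⇛ x))) (K-valid x x)

record QHCAlgebra : Set₁ where
  field
    Carrierᴾ Carrierᴮ : Set
    connectivesᴾ : Connectives Carrierᴾ
    connectivesᴮ : Connectives Carrierᴮ
    ¿ᴹ : Carrierᴮ → Carrierᴾ
    ¡ᴹ : Carrierᴾ → Carrierᴮ

  module P = Connectives connectivesᴾ
  module B = Connectives connectivesᴮ

  field
    isHilbertᴾ : IsHilbertAlgebra connectivesᴾ
    isHilbertᴮ : IsHilbertAlgebra connectivesᴮ
    dne-valid  : ∀ x → P.∼ P.∼ x P.⇛ x ≡ P.⊤
    ¿-⊤        : ¿ᴹ B.⊤ ≡ P.⊤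
    ¿K-valid   : ∀ x y → ¿ᴹ (x B.⇛ y) P.⇛ ¿ᴹ x P.⇛ ¿ᴹ y ≡ P.⊤
    ¿¡E-valid  : ∀ x → ¿ᴹ (¡ᴹ x) P.⇛ x ≡ P.⊤
    ¡-⊤        : ¡ᴹ P.⊤ ≡ B.⊤
    ¡K-valid   : ∀ x y → ¡ᴹ (x P.⇛ y) B.⇛ ¡ᴹ x B.⇛ ¡ᴹ y ≡ B.⊤
    ¬¡𝟘-valid  : B.∼ ¡ᴹ P.⊥ ≡ B.⊤
    ∇I-valid   : ∀ x → x B.⇛ ¡ᴹ (¿ᴹ x) ≡ B.⊤

  □ᴹ : Carrierᴾ → Carrierᴾ
  □ᴹ x = ¿ᴹ (¡ᴹ x)

  ∇ᴹ : Carrierᴮ → Carrierᴮ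
  ∇ᴹ x = ¡ᴹ (¿ᴹ x)

-- Individuals range over a one-element domain: quantifiers are interpreted
-- by their bodies and renaming variables does not change values.
module Evaluation (𝔄 : QHCAlgebra)
                  (atomᴾ : ℕ → QHCAlgebra.Carrierᴾ 𝔄)
                  (atomᴮ : ℕ → QHCAlgebra.Carrierᴮ 𝔄) where
  open QHCAlgebra 𝔄
  module Pᴴ = IsHilbertAlgebra isHilbertᴾ
  module Bᴴ = IsHilbertAlgebra isHilbertᴮ

  mutual
    ⟦_⟧ᴾ : Prp → Carrierᴾ
    ⟦ atomP n _ ⟧ᴾ = atomᴾ n
    ⟦ ¿ a ⟧ᴾ       = ¿ᴹ ⟦ a ⟧ᴮ
    ⟦ p ∧ q ⟧ᴾ     = ⟦ p ⟧ᴾ P.⊓ ⟦ q ⟧ᴾ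
    ⟦ p ∨ q ⟧ᴾ     = ⟦ p ⟧ᴾ P.⊔ ⟦ q ⟧ᴾ
    ⟦ p ⇒ q ⟧ᴾ     = ⟦ p ⟧ᴾ P.⇛ ⟦ q ⟧ᴾ
    ⟦ ~ p ⟧ᴾ       = P.∼ ⟦ p ⟧ᴾ
    ⟦ 𝟘 ⟧ᴾ         = P.⊥
    ⟦ ∀p p ⟧ᴾ      = ⟦ p ⟧ᴾ
    ⟦ ∃p p ⟧ᴾ      = ⟦ p ⟧ᴾ

    ⟦_⟧ᴮ : Prb → Carrierᴮ
    ⟦ atomB n _ ⟧ᴮ = atomᴮ n
    ⟦ ¡ p ⟧ᴮ       = ¡ᴹ ⟦ p ⟧ᴾ
    ⟦ a ∧ᵇ b ⟧ᴮ    = ⟦ a ⟧ᴮ B.⊓ ⟦ b ⟧ᴮ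
    ⟦ a ∨ᵇ b ⟧ᴮ    = ⟦ a ⟧ᴮ B.⊔ ⟦ b ⟧ᴮ
    ⟦ a ⇒ᵇ b ⟧ᴮ    = ⟦ a ⟧ᴮ B.⇛ ⟦ b ⟧ᴮ
    ⟦ ~ᵇ a ⟧ᴮ      = B.∼ ⟦ a ⟧ᴮ
    ⟦ ⊥ᵇ ⟧ᴮ        = B.⊥
    ⟦ ∀b a ⟧ᴮ      = ⟦ a ⟧ᴮ
    ⟦ ∃b a ⟧ᴮ      = ⟦ a ⟧ᴮ

  mutual
    renP-invariant : ∀ ρ p → ⟦ renP ρ p ⟧ᴾ ≡ ⟦ p ⟧ᴾ
    renP-invariant ρ (atomP n ts) = refl
    renP-invariant ρ (¿ a)        = cong ¿ᴹ (renB-invariant ρ a)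
    renP-invariant ρ (p ∧ q)      = cong₂ P._⊓_ (renP-invariant ρ p) (renP-invariant ρ q)
    renP-invariant ρ (p ∨ q)      = cong₂ P._⊔_ (renP-invariant ρ p) (renP-invariant ρ q)
    renP-invariant ρ (p ⇒ q)      = cong₂ P._⇛_ (renP-invariant ρ p) (renP-invariant ρ q)
    renP-invariant ρ (~ p)        = cong P.∼_ (renP-invariant ρ p)
    renP-invariant ρ 𝟘            = refl
    renP-invariant ρ (∀p p)       = renP-invariant (lift ρ) p
    renP-invariant ρ (∃p p)       = renP-invariant (lift ρ) p

    renB-invariant : ∀ ρ a → ⟦ renB ρ a ⟧ᴮ ≡ ⟦ a ⟧ᴮ
    renB-invariant ρ (atomB n ts) = refl
    renB-invariant ρ (¡ p)        = cong ¡ᴹ (renP-invariant ρ p)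
    renB-invariant ρ (a ∧ᵇ b)     = cong₂ B._⊓_ (renB-invariant ρ a) (renB-invariant ρ b)
    renB-invariant ρ (a ∨ᵇ b)     = cong₂ B._⊔_ (renB-invariant ρ a) (renB-invariant ρ b)
    renB-invariant ρ (a ⇒ᵇ b)     = cong₂ B._⇛_ (renB-invariant ρ a) (renB-invariant ρ b)
    renB-invariant ρ (~ᵇ a)       = cong B.∼_ (renB-invariant ρ a)
    renB-invariant ρ ⊥ᵇ           = refl
    renB-invariant ρ (∀b a)       = renB-invariant (lift ρ) a
    renB-invariant ρ (∃b a)       = renB-invariant (lift ρ) a

  Satisfies : Theory → Set
  Satisfies T = (∀ p → axP T p → ⟦ p ⟧ᴾ ≡ P.⊤) × (∀ a → axB T a → ⟦ a ⟧ᴮ ≡ B.⊤)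

  mutual
    soundᴾ : ∀ {T} → Satisfies T → ∀ {p} → T ⊢P p → ⟦ p ⟧ᴾ ≡ P.⊤
    soundᴾ (sat , _) (extra x)     = sat _ x
    soundᴾ s K                     = Pᴴ.K-valid _ _
    soundᴾ s S                     = Pᴴ.S-valid _ _ _
    soundᴾ s ∧I                    = Pᴴ.∧I-valid _ _
    soundᴾ s ∧E₁                   = Pᴴ.∧E₁-valid _ _
    soundᴾ s ∧E₂                   = Pᴴ.∧E₂-valid _ _
    soundᴾ s ∨I₁                   = Pᴴ.∨I₁-valid _ _
    soundᴾ s ∨I₂                   = Pᴴ.∨I₂-valid _ _
    soundᴾ s ∨E                    = Pᴴ.∨E-valid _ _ _
    soundᴾ s efq                   = Pᴴ.efq-valid _
    soundᴾ s ¬I                    = Pᴴ.¬I-valid _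
    soundᴾ s ¬E                    = Pᴴ.¬E-valid _
    soundᴾ s dne                   = dne-valid _
    soundᴾ s (mp d e)              = Pᴴ.mp-valid (soundᴾ s d) (soundᴾ s e)
    soundᴾ s (∀E {p} t)            = subst (λ z → ⟦ p ⟧ᴾ P.⇛ z ≡ P.⊤) (sym (renP-invariant (sub0 t) p)) (Pᴴ.⇛-refl _)
    soundᴾ s (∃I {p} t)            = subst (λ z → z P.⇛ ⟦ p ⟧ᴾ ≡ P.⊤) (sym (renP-invariant (sub0 t) p)) (Pᴴ.⇛-refl _)
    soundᴾ s (gen d)               = soundᴾ s d
    soundᴾ s (∀R {q} {p} d)        = subst (λ z → z P.⇛ ⟦ p ⟧ᴾ ≡ P.⊤) (renP-invariant suc q) (soundᴾ s d)
    soundᴾ s (∃R {q} {p} d)        = subst (λ z → ⟦ p ⟧ᴾ P.⇛ z ≡ P.⊤) (renP-invariant suc q) (soundᴾ s d)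
    soundᴾ s (¿rule d)             = trans (cong ¿ᴹ (soundᴮ s d)) ¿-⊤
    soundᴾ s ¿K                    = ¿K-valid _ _
    soundᴾ s ¿¡E                   = ¿¡E-valid _

    soundᴮ : ∀ {T} → Satisfies T → ∀ {a} → T ⊢B a → ⟦ a ⟧ᴮ ≡ B.⊤
    soundᴮ (_ , sat) (extra x)     = sat _ x
    soundᴮ s K                     = Bᴴ.K-valid _ _
    soundᴮ s S                     = Bᴴ.S-valid _ _ _
    soundᴮ s ∧I                    = Bᴴ.∧I-valid _ _
    soundᴮ s ∧E₁                   = Bᴴ.∧E₁-valid _ _
    soundᴮ s ∧E₂                   = Bᴴ.∧E₂-valid _ _
    soundᴮ s ∨I₁                   = Bᴴ.∨I₁-valid _ _
    soundᴮ s ∨I₂                   = Bᴴ.∨I₂-valid _ _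
    soundᴮ s ∨E                    = Bᴴ.∨E-valid _ _ _
    soundᴮ s efq                   = Bᴴ.efq-valid _
    soundᴮ s ¬I                    = Bᴴ.¬I-valid _
    soundᴮ s ¬E                    = Bᴴ.¬E-valid _
    soundᴮ s (mp d e)              = Bᴴ.mp-valid (soundᴮ s d) (soundᴮ s e)
    soundᴮ s (∀E {a} t)            = subst (λ z → ⟦ a ⟧ᴮ B.⇛ z ≡ B.⊤) (sym (renB-invariant (sub0 t) a)) (Bᴴ.⇛-refl _)
    soundᴮ s (∃I {a} t)            = subst (λ z → z B.⇛ ⟦ a ⟧ᴮ ≡ B.⊤) (sym (renB-invariant (sub0 t) a)) (Bᴴ.⇛-refl _)
    soundᴮ s (gen d)               = soundᴮ s d
    soundᴮ s (∀R {c} {a} d)        = subst (λ z → z B.⇛ ⟦ a ⟧ᴮ ≡ B.⊤) (renB-invariant suc c) (soundᴮ s d)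
    soundᴮ s (∃R {c} {a} d)        = subst (λ z → ⟦ a ⟧ᴮ B.⇛ z ≡ B.⊤) (renB-invariant suc c) (soundᴮ s d)
    soundᴮ s (¡rule d)             = trans (cong ¡ᴹ (soundᴾ s d)) ¡-⊤
    soundᴮ s ¡K                    = ¡K-valid _ _
    soundᴮ s ¬¡𝟘                   = ¬¡𝟘-valid
    soundᴮ s ∇I                    = ∇I-valid _

  strictlyStronger : ∀ {X Y} → Derives X Y → Satisfies Y → ¬ Satisfies X → StrictlyStronger X Y
  strictlyStronger X⊢Y satY ¬satX = X⊢Y , λ (Y⊢ᴾX , Y⊢ᴮX) →
    ¬satX ((λ p x → soundᴾ satY (Y⊢ᴾX p x)) , (λ a x → soundᴮ satY (Y⊢ᴮX a x)))

  satisfies-qStar : (∀ x y → (¿ᴹ x P.⇛ ¿ᴹ y) P.⟺ ¿ᴹ (∇ᴹ x B.⇛ ∇ᴹ y) ≡ P.⊤) →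
                    Satisfies QStarPrinciple
  satisfies-qStar valid = (λ { _ (a , b , refl) → valid ⟦ a ⟧ᴮ ⟦ b ⟧ᴮ }) , λ _ ()

  satisfies-q : (∀ x y → ¿ᴹ (x B.⇛ y) P.⟺ □ᴹ (¿ᴹ x P.⇛ ¿ᴹ y) ≡ P.⊤) → Satisfies QPrinciple
  satisfies-q valid = (λ { _ (a , b , refl) → valid ⟦ a ⟧ᴮ ⟦ b ⟧ᴮ }) , λ _ ()

  satisfies-noIgnorabimus : (∀ x → ¿ᴹ (B.∼ x) P.⟺ P.∼ ¿ᴹ x ≡ P.⊤) →
                            Satisfies NoIgnorabimusPrinciple
  satisfies-noIgnorabimus valid = (λ { _ (a , refl) → valid ⟦ a ⟧ᴮ }) , λ _ ()

record Searchable (A : Set) : Set₁ where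
  field
    search : ∀ {P : A → Set} → Decidable P → Dec (∀ x → P x)

open Searchable {{...}}

instance
  Bool-searchable : Searchable Bool
  Bool-searchable .search P? = map′ (λ { (t , f) true → t ; (t , f) false → f })
                                    (λ h → h true , h false) (P? true ×-dec P? false)

  Fin-searchable : ∀ {n} → Searchable (Fin n)
  Fin-searchable .search = Fin.all?

  ×-searchable : ∀ {A B} {{_ : Searchable A}} {{_ : Searchable B}} → Searchable (A × B)
  ×-searchable .search P? = map′ (λ h (x , y) → h x y) (λ h x y → h (x , y))
                                 (search λ x → search λ y → P? (x , y))

-- The implicit certificate reduces to the unit type exactly when both sides
-- agree at every point, so it is filled in by normalisation.
module _ {D R : Set} {{_ : Searchable D}} {{_ : IsDecEquivalence {A = R} _≡_}} where

  exhaustive₁ : {f g : D → R} {✓ : True (search λ x → f x ≟ g x)} → ∀ x → f x ≡ g x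
  exhaustive₁ {✓ = ✓} = toWitness ✓

  exhaustive₂ : {f g : D → D → R} {✓ : True (search λ x → search λ y → f x y ≟ g x y)} →
              ∀ x y → f x y ≡ g x y
  exhaustive₂ {✓ = ✓} = toWitness ✓

  exhaustive₃ : {f g : D → D → D → R}
              {✓ : True (search λ x → search λ y → search λ z → f x y z ≟ g x y z)} →
              ∀ x y z → f x y z ≡ g x y z
  exhaustive₃ {✓ = ✓} = toWitness ✓

boolean : Connectives Bool
boolean = record
  { ⊤ = true ; ⊥ = false ; _⊓_ = Bool._∧_ ; _⊔_ = Bool._∨_
  ; _⇛_ = λ x y → not x Bool.∨ y ; ∼_ = not }

square : ∀ {A} → Connectives A → Connectives (A × A)
square {A} C = record
  { ⊤ = ⊤ , ⊤ ; ⊥ = ⊥ , ⊥ ; _⊓_ = pointwise _⊓_ ; _⊔_ = pointwise _⊔_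
  ; _⇛_ = pointwise _⇛_ ; ∼_ = λ (x , x′) → ∼ x , ∼ x′ }
  where
  open Connectives C
  pointwise : (A → A → A) → A × A → A × A → A × A
  pointwise _∙_ (x , x′) (y , y′) = x ∙ y , x′ ∙ y′

gödelChain : (n : ℕ) → Connectives (Fin (suc n))
gödelChain n = record
  { ⊤ = fromℕ n ; ⊥ = zero
  ; _⊓_ = λ x y → if x ≤ᵇ y then x else y
  ; _⊔_ = λ x y → if x ≤ᵇ y then y else x
  ; _⇛_ = _⇛_ ; ∼_ = λ x → x ⇛ zero }
  where
  _≤ᵇ_ : Fin (suc n) → Fin (suc n) → Bool
  x ≤ᵇ y = does (x Fin.≤? y)

  _⇛_ : Fin (suc n) → Fin (suc n) → Fin (suc n)
  x ⇛ y = if x ≤ᵇ y then fromℕ n else y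

Bool² : Connectives (Bool × Bool)
Bool² = square boolean

Chain₃ : Connectives (Fin 3)
Chain₃ = gödelChain 2

Bool²-isHilbert : IsHilbertAlgebra Bool²
Bool²-isHilbert = record
  { K-valid = exhaustive₂ ; S-valid = exhaustive₃ ; ∧I-valid = exhaustive₂
  ; ∧E₁-valid = exhaustive₂ ; ∧E₂-valid = exhaustive₂ ; ∨I₁-valid = exhaustive₂
  ; ∨I₂-valid = exhaustive₂ ; ∨E-valid = exhaustive₃ ; efq-valid = exhaustive₁
  ; ¬I-valid = exhaustive₁ ; ¬E-valid = exhaustive₁ ; ⊤⇛-identity = exhaustive₁ }

Chain₃-isHilbert : IsHilbertAlgebra Chain₃
Chain₃-isHilbert = record
  { K-valid = exhaustive₂ ; S-valid = exhaustive₃ ; ∧I-valid = exhaustive₂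
  ; ∧E₁-valid = exhaustive₂ ; ∧E₂-valid = exhaustive₂ ; ∨I₁-valid = exhaustive₂
  ; ∨I₂-valid = exhaustive₂ ; ∨E-valid = exhaustive₃ ; efq-valid = exhaustive₁
  ; ¬I-valid = exhaustive₁ ; ¬E-valid = exhaustive₁ ; ⊤⇛-identity = exhaustive₁ }

-- In both models ¡ x is the largest h with ? h ≤ x.  In 𝔐₁, ? identifies
-- 1F with 2F, a Heyting homomorphism onto the diagonal of Bool², which
-- validates ?¬α ↔ ¬?α and the ?*-principle; but ! sends both (1,0) and its
-- complement (0,1) to 0F, which refutes stability and the !-principle.
-- In 𝔐₂, ? embeds the chain as (0,0) < (0,1) < (1,1), and α = 1F, β = ⊥
-- refutes the ?*-principle.
¿₁ : Fin 3 → Bool × Bool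
¿₁ 0F = false , false
¿₁ _  = true , true

¡₁ : Bool × Bool → Fin 3
¡₁ (true , true) = 2F
¡₁ _             = 0F

¿₂ : Fin 3 → Bool × Bool
¿₂ 0F = false , false
¿₂ 1F = false , true
¿₂ 2F = true , true

¡₂ : Bool × Bool → Fin 3
¡₂ (true , true)  = 2F
¡₂ (false , true) = 1F
¡₂ (_ , false)    = 0F

𝔐₁ : QHCAlgebra
𝔐₁ = record
  { connectivesᴾ = Bool² ; connectivesᴮ = Chain₃ ; ¿ᴹ = ¿₁ ; ¡ᴹ = ¡₁
  ; isHilbertᴾ = Bool²-isHilbert ; isHilbertᴮ = Chain₃-isHilbert ; dne-valid = exhaustive₁
  ; ¿-⊤ = refl ; ¿K-valid = exhaustive₂ ; ¿¡E-valid = exhaustive₁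
  ; ¡-⊤ = refl ; ¡K-valid = exhaustive₂ ; ¬¡𝟘-valid = refl ; ∇I-valid = exhaustive₁ }

𝔐₂ : QHCAlgebra
𝔐₂ = record
  { connectivesᴾ = Bool² ; connectivesᴮ = Chain₃ ; ¿ᴹ = ¿₂ ; ¡ᴹ = ¡₂
  ; isHilbertᴾ = Bool²-isHilbert ; isHilbertᴮ = Chain₃-isHilbert ; dne-valid = exhaustive₁
  ; ¿-⊤ = refl ; ¿K-valid = exhaustive₂ ; ¿¡E-valid = exhaustive₁
  ; ¡-⊤ = refl ; ¡K-valid = exhaustive₂ ; ¬¡𝟘-valid = refl ; ∇I-valid = exhaustive₁ }

module M₁ = Evaluation 𝔐₁ (λ _ → true , false) (λ _ → 0F)
module M₂ = Evaluation 𝔐₂ (λ _ → true , true) (λ _ → 1F)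

M₁-refutes-bang : ¬ M₁.Satisfies BangPrinciple
M₁-refutes-bang (_ , sat) with sat _ (atomP 0 [] , 𝟘 , refl)
... | ()

M₁-refutes-stability : ¬ M₁.Satisfies StabilityPrinciple
M₁-refutes-stability (_ , sat) with sat _ (atomP 0 [] , refl)
... | ()

M₂-refutes-qStar : ¬ M₂.Satisfies QStarPrinciple
M₂-refutes-qStar (sat , _) with sat _ (atomB 0 [] , ⊥ᵇ , refl)
... | ()

mainTheorem8 : (StrictlyStronger BangPrinciple QStarPrinciple × StrictlyStronger QStarPrinciple QPrinciple) × StrictlyStronger StabilityPrinciple NoIgnorabimusPrinciple
mainTheorem8 =
  ( M₁.strictlyStronger bang⇒qStar (M₁.satisfies-qStar exhaustive₂) M₁-refutes-bang
  , M₂.strictlyStronger qStar⇒q (M₂.satisfies-q exhaustive₂) M₂-refutes-qStar )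
  , M₁.strictlyStronger stability⇒noIgnorabimus
      (M₁.satisfies-noIgnorabimus exhaustive₁) M₁-refutes-stability
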